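{- Let $f$ be an energy function and $x\in\mathbb{R}_{\ge0}$. If $xf<x$, then there is $N\in\mathbb N$ for which $xf^N$ is not defined. If $xf>x$, then for every $P\in\mathbb R$ there is $N\in\mathbb N$ for which $xf^N\ge P$.
   Context: An energy function is a partial function $f:\mathbb{R}_{\ge0}\rightharpoonup\mathbb{R}_{\ge0}$ whose domain is an interval $[l_f,\infty)$ or $(l_f,\infty)$ for some $l_f\ge0$, such that $yf\ge xf+y-x$ for all $x\le y$ in its domain. Here $xf$ denotes $f(x)$, and $xf^N$ denotes the $N$-fold iterate $f(f(\cdots f(x)))$, defined only when every intermediate application is defined. -}

module Defs where

open import Data.Nat using (ℕ; zero; suc)
open import Data.Product using (Σ; ∃; _×_; _,_)
open import Data.Bool using (Bool; true; false)
open import Relation.Nullary using (¬_)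
open import Relation.Binary.PropositionalEquality using (_≡_)
open import Algebra.Structures using (IsCommutativeRing)
open import Relation.Binary.Structures using (IsTotalOrder)

embedℕ : {A : Set} → A → A → (A → A → A) → ℕ → A
embedℕ z o p zero    = z
embedℕ z o p (suc n) = p o (embedℕ z o p n)

-- An abstract model of the real numbers: a complete (Dedekind/sup-complete)
-- ordered field.  The statement is quantified over every such model, so it
-- is in particular about ℝ.  (Archimedean property is also listed; it holds
-- in ℝ and follows classically from completeness.)
record RealNumbers : Set₁ where
  infixl 6 _+_ _-_
  infixl 7 _*_
  infix  4 _≤_ _<_
  field
    ℝ   : Set
    0# 1# : ℝ
    _+_ _*_ : ℝ → ℝ → ℝ
    -_  : ℝ → ℝ
    _≤_ : ℝ → ℝ → Set
    isCommutativeRing : IsCommutativeRing _≡_ _+_ _*_ -_ 0# 1#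
    isTotalOrder      : IsTotalOrder _≡_ _≤_
    0≢1       : ¬ (0# ≡ 1#)
    inverse   : ∀ a → ¬ (a ≡ 0#) → ∃ λ b → a * b ≡ 1#
    +-mono-≤  : ∀ a b c → a ≤ b → a + c ≤ b + c
    *-nonneg  : ∀ a b → 0# ≤ a → 0# ≤ b → 0# ≤ a * b
    complete  : (S : ℝ → Set) → (∃ λ s → S s) → (∃ λ u → ∀ y → S y → y ≤ u) →
                ∃ λ s → (∀ y → S y → y ≤ s) × (∀ u → (∀ y → S y → y ≤ u) → s ≤ u)
    archimedean : ∀ a → ∃ λ (n : ℕ) → a ≤ embedℕ 0# 1# _+_ n

  _-_ : ℝ → ℝ → ℝ
  a - b = a + (- b)

  _<_ : ℝ → ℝ → Set
  a < b = (a ≤ b) × ¬ (a ≡ b)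

module _ (RN : RealNumbers) where
  open RealNumbers RN

  Interval : ℝ → Bool → ℝ → Set
  Interval l true  x = l ≤ x
  Interval l false x = l < x

  record EnergyFunction : Set where
    field
      l      : ℝ
      0≤l    : 0# ≤ l
      closed : Bool
      app    : (x : ℝ) → Interval l closed x → ℝ
      nonneg : ∀ x (dx : Interval l closed x) → 0# ≤ app x dx
      energy : ∀ x y (dx : Interval l closed x) (dy : Interval l closed y) →
               x ≤ y → app x dx + y - x ≤ app y dy

    Dom : ℝ → Set
    Dom = Interval l closed

  open EnergyFunction

  -- Iter f N x v : "x f^N is defined and equals v" (every intermediate
  -- application defined).
  data Iter (f : EnergyFunction) : ℕ → ℝ → ℝ → Set where
    iter-zero : ∀ x → Iter f zero x x
    iter-suc  : ∀ {n x v} (dx : Dom f x) → Iter f n (app f x dx) v → Iter f (suc n) x v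

module Submission where

-- Applying the energy inequality
-- yf ≥ xf + y − x  (x ≤ y) between x and a second point controls how far
-- f moves that point:
--   * If xf < x, every point y ≤ x of the domain is moved down by at least
--     δ = x − xf > 0.  Hence a defined iterate x f^N satisfies
--     x f^N + N·δ ≤ x, and since iterates are nonnegative, N·δ ≤ x.
--     Choosing N with x < N·δ (Archimedean property) shows that x f^N
--     cannot be defined.
--   * If x < xf, the domain is upward closed and every point y ≥ x is moved
--     up by at least γ = xf − x > 0, so all iterates are defined and
--     x f^N ≥ x + N·γ, which exceeds any bound P for N large.

open import Defs
open import Data.Nat using (ℕ; zero; suc)
open import Data.Bool using (true; false)
open import Data.Product using (∃; _×_; _,_; proj₁; proj₂)
open import Relation.Nullary using (¬_)
open import Relation.Binary.PropositionalEquality using (_≡_; sym; trans; cong; subst)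
open import Relation.Binary.Bundles using (Poset)
open import Relation.Binary.Structures using (IsTotalOrder)
open import Algebra.Structures using (IsCommutativeRing)
open import Algebra.Bundles using (CommutativeRing)
import Algebra.Properties.Group as GroupProperties
import Algebra.Properties.AbelianGroup as AbelianGroupProperties
import Algebra.Properties.CommutativeSemigroup as CommutativeSemigroupProperties
import Algebra.Properties.Ring as RingProperties
import Relation.Binary.Reasoning.PartialOrder as PosetReasoning

module OrderedField (RN : RealNumbers) where
  open RealNumbers RN
  open IsTotalOrder isTotalOrder public using (antisym; reflexive) renaming (refl to ≤-refl; trans to ≤-trans)
  open IsCommutativeRing isCommutativeRing using (+-identityˡ; +-identityʳ; -‿inverseʳ; zeroˡ; *-identityˡ; *-identityʳ; *-assoc; *-comm; distribʳ)

  commutativeRing : CommutativeRing _ _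
  commutativeRing = record { isCommutativeRing = isCommutativeRing }

  poset : Poset _ _ _
  poset = record { isPartialOrder = IsTotalOrder.isPartialOrder isTotalOrder }

  open RingProperties (CommutativeRing.ring commutativeRing) using (-‿distribˡ-*)
  open GroupProperties (CommutativeRing.+-group commutativeRing)
    renaming (//-rightDividesˡ to -+-cancel; //-rightDividesʳ to +--cancel)
    using ()
  open PosetReasoning poset using (begin_; step-≤; step-≡-⟩; step-≡-⟨; _∎)

  ≤⇒0≤- : ∀ {a b} → a ≤ b → 0# ≤ b - a
  ≤⇒0≤- {a} {b} a≤b = begin
    0#      ≡⟨ -‿inverseʳ a ⟨
    a - a   ≤⟨ +-mono-≤ a b (- a) a≤b ⟩
    b - a   ∎

  0≤-⇒≤ : ∀ {a b} → 0# ≤ b - a → a ≤ b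
  0≤-⇒≤ {a} {b} 0≤b-a = begin
    a             ≡⟨ +-identityˡ a ⟨
    0# + a        ≤⟨ +-mono-≤ 0# (b - a) a 0≤b-a ⟩
    (b - a) + a   ≡⟨ -+-cancel a b ⟩
    b             ∎

  ≤-+-nonneg : ∀ a {c} → 0# ≤ c → a ≤ c + a
  ≤-+-nonneg a {c} 0≤c = begin
    a        ≡⟨ +-identityˡ a ⟨
    0# + a   ≤⟨ +-mono-≤ 0# c a 0≤c ⟩
    c + a    ∎

  <⇒0<- : ∀ {a b} → a < b → 0# < b - a
  <⇒0<- {a} {b} (a≤b , a≢b) = ≤⇒0≤- a≤b , λ 0≡b-a → a≢b (a≡b 0≡b-a)
    where
    a≡b : 0# ≡ b - a → a ≡ b
    a≡b 0≡b-a = trans (sym (+-identityˡ a)) (trans (cong (_+ a) 0≡b-a) (-+-cancel a b))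

  *-monoʳ-≤-nonneg : ∀ {a b} c → 0# ≤ c → a ≤ b → a * c ≤ b * c
  *-monoʳ-≤-nonneg {a} {b} c 0≤c a≤b = 0≤-⇒≤ (begin
    0#              ≤⟨ *-nonneg (b - a) c (≤⇒0≤- a≤b) 0≤c ⟩
    (b - a) * c     ≡⟨ distribʳ c b (- a) ⟩
    b * c + - a * c ≡⟨ cong (b * c +_) (-‿distribˡ-* a c) ⟨
    b * c - a * c   ∎)

  infixl 7 _·_
  _·_ : ℕ → ℝ → ℝ
  n · d = embedℕ 0# 1# _+_ n * d

  +-zero·-identity : ∀ a d → a + zero · d ≡ a
  +-zero·-identity a d = trans (cong (a +_) (zeroˡ d)) (+-identityʳ a)

  suc·-unfold : ∀ n d → suc n · d ≡ d + n · d
  suc·-unfold n d = trans (distribʳ d 1# (embedℕ 0# 1# _+_ n)) (cong (_+ n · d) (*-identityˡ d))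

  -- Archimedean property for an arbitrary positive unit d: some multiple
  -- of d exceeds any given P.  The field axioms provide it for the unit 1;
  -- rescale by d⁻¹, then take one more step to make the inequality strict.
  archimedean-multiple : ∀ {d} → 0# < d → ∀ P → ∃ λ N → P < N · d
  archimedean-multiple {d} (0≤d , 0≢d) P with inverse d (λ d≡0 → 0≢d (sym d≡0))
  ... | d⁻¹ , d*d⁻¹≡1 with archimedean (P * d⁻¹)
  ... | N , P*d⁻¹≤N = suc N , P≤suc-N·d , P≢suc-N·d
    where
    P≤N·d : P ≤ N · d
    P≤N·d = begin
      P               ≡⟨ *-identityʳ P ⟨
      P * 1#          ≡⟨ cong (P *_) d*d⁻¹≡1 ⟨
      P * (d * d⁻¹)   ≡⟨ cong (P *_) (*-comm d d⁻¹) ⟩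
      P * (d⁻¹ * d)   ≡⟨ *-assoc P d⁻¹ d ⟨
      P * d⁻¹ * d     ≤⟨ *-monoʳ-≤-nonneg d 0≤d P*d⁻¹≤N ⟩
      N · d           ∎

    P≤suc-N·d : P ≤ suc N · d
    P≤suc-N·d = begin
      P           ≤⟨ P≤N·d ⟩
      N · d       ≤⟨ ≤-+-nonneg (N · d) 0≤d ⟩
      d + N · d   ≡⟨ suc·-unfold N d ⟨
      suc N · d   ∎

    -- P = (N+1)·d would force d + N·d ≤ N·d, i.e. d ≤ 0.
    P≢suc-N·d : ¬ (P ≡ suc N · d)
    P≢suc-N·d P≡suc-N·d = 0≢d (antisym 0≤d d≤0)
      where
      d≤0 : d ≤ 0#
      d≤0 = begin
        d                     ≡⟨ +--cancel (N · d) d ⟨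
        (d + N · d) - N · d   ≡⟨ cong (_- N · d) (trans P≡suc-N·d (suc·-unfold N d)) ⟨
        P - N · d             ≤⟨ +-mono-≤ P (N · d) (- (N · d)) P≤N·d ⟩
        N · d - N · d         ≡⟨ -‿inverseʳ (N · d) ⟩
        0#                    ∎

module Energy (RN : RealNumbers) where
  open RealNumbers RN
  open OrderedField RN
  open IsCommutativeRing isCommutativeRing using (+-assoc; +-comm)
  open GroupProperties (CommutativeRing.+-group commutativeRing) using () renaming (//-rightDividesˡ to -+-cancel)
  open AbelianGroupProperties (CommutativeRing.+-abelianGroup commutativeRing) using (xyx⁻¹≈y)
  open CommutativeSemigroupProperties (CommutativeRing.+-commutativeSemigroup commutativeRing) using (x∙yz≈yx∙z; x∙yz≈xz∙y)
  open PosetReasoning poset using (begin_; step-≤; step-≡-⟩; step-≡-⟨; _∎)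
  open EnergyFunction

  Interval-upward : ∀ {l y z} b → Interval RN l b y → y ≤ z → Interval RN l b z
  Interval-upward true  l≤y          y≤z = ≤-trans l≤y y≤z
  Interval-upward false (l≤y , l≢y) y≤z =
    ≤-trans l≤y y≤z , λ l≡z → l≢y (antisym l≤y (subst (_ ≤_) (sym l≡z) y≤z))

  module _ (f : EnergyFunction RN) where

    iterate-nonneg : ∀ {n y v} → Iter RN f n y v → 0# ≤ y → 0# ≤ v
    iterate-nonneg (iter-zero y)     0≤y = 0≤y
    iterate-nonneg (iter-suc dy it) _   = iterate-nonneg it (nonneg f _ dy)

    -- Energy inequality at (y, x) with y ≤ x: below x every point is moved
    -- down by at least the drop x − xf of x.
    descent-step : ∀ {x y} (dx : Dom f x) (dy : Dom f y) → y ≤ x →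
                   app f y dy + (x - app f x dx) ≤ y
    descent-step {x} {y} dx dy y≤x = begin
      yf + (x - xf)           ≡⟨ +-assoc yf x (- xf) ⟨
      (yf + x) - xf           ≡⟨ cong (_- xf) (-+-cancel y (yf + x)) ⟨
      ((yf + x - y) + y) - xf ≤⟨ +-mono-≤ _ _ (- xf) (+-mono-≤ _ _ y (energy f y x dy dx y≤x)) ⟩
      (xf + y) - xf           ≡⟨ xyx⁻¹≈y xf y ⟩
      y                       ∎
      where
      xf = app f x dx
      yf = app f y dy

    -- Energy inequality at (x, y) with x ≤ y: above x every point is moved
    -- up by at least the gain xf − x of x.
    ascent-step : ∀ {x y} (dx : Dom f x) (dy : Dom f y) → x ≤ y →
                  y + (app f x dx - x) ≤ app f y dy
    ascent-step {x} {y} dx dy x≤y = begin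
      y + (xf - x)   ≡⟨ x∙yz≈yx∙z y xf (- x) ⟩
      (xf + y) - x   ≤⟨ energy f x y dx dy x≤y ⟩
      app f y dy     ∎
      where xf = app f x dx

    descent : ∀ {x} (dx : Dom f x) → 0# ≤ x - app f x dx →
              ∀ n {y v} → Iter RN f n y v → y ≤ x → v + n · (x - app f x dx) ≤ y
    descent {x} dx 0≤δ zero (iter-zero y) _ = reflexive (+-zero·-identity y (x - app f x dx))
    descent {x} dx 0≤δ (suc n) {y} {v} (iter-suc dy it) y≤x = begin
      v + suc n · δ    ≡⟨ cong (v +_) (suc·-unfold n δ) ⟩
      v + (δ + n · δ)  ≡⟨ x∙yz≈xz∙y v δ (n · δ) ⟩
      (v + n · δ) + δ  ≤⟨ +-mono-≤ _ _ δ (descent dx 0≤δ n it yf≤x) ⟩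
      yf + δ           ≤⟨ descent-step dx dy y≤x ⟩
      y                ∎
      where
      δ  = x - app f x dx
      yf = app f y dy
      yf≤x : yf ≤ x
      yf≤x = begin
        yf       ≤⟨ ≤-+-nonneg yf 0≤δ ⟩
        δ + yf   ≡⟨ +-comm δ yf ⟩
        yf + δ   ≤⟨ descent-step dx dy y≤x ⟩
        y        ≤⟨ y≤x ⟩
        x        ∎

    ascent : ∀ {x} (dx : Dom f x) → 0# ≤ app f x dx - x →
             ∀ n y → x ≤ y → ∃ λ v → Iter RN f n y v × y + n · (app f x dx - x) ≤ v
    ascent {x} dx 0≤γ zero y _ = y , iter-zero y , reflexive (+-zero·-identity y (app f x dx - x))
    ascent {x} dx 0≤γ (suc n) y x≤y =
      let v , it , yf+nγ≤v = ascent dx 0≤γ n yf x≤yf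
      in v , iter-suc dy it , (begin
        y + suc n · γ     ≡⟨ cong (y +_) (suc·-unfold n γ) ⟩
        y + (γ + n · γ)   ≡⟨ +-assoc y γ (n · γ) ⟨
        (y + γ) + n · γ   ≤⟨ +-mono-≤ _ _ (n · γ) (ascent-step dx dy x≤y) ⟩
        yf + n · γ        ≤⟨ yf+nγ≤v ⟩
        v                 ∎)
      where
      γ  = app f x dx - x
      dy = Interval-upward (closed f) dx x≤y
      yf = app f y dy
      x≤yf : x ≤ yf
      x≤yf = begin
        x       ≤⟨ x≤y ⟩
        y       ≤⟨ ≤-+-nonneg y 0≤γ ⟩
        γ + y   ≡⟨ +-comm γ y ⟩
        y + γ   ≤⟨ ascent-step dx dy x≤y ⟩
        yf      ∎

    eventually-undefined : ∀ {x} → 0# ≤ x → (dx : Dom f x) → app f x dx < x →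
                           ∃ λ N → ¬ (∃ λ v → Iter RN f N x v)
    eventually-undefined {x} 0≤x dx xf<x =
      let N , x<N·δ = archimedean-multiple 0<δ x
      in N , λ (v , it) → proj₂ x<N·δ (antisym (proj₁ x<N·δ) (N·δ≤x N v it))
      where
      δ = x - app f x dx
      0<δ : 0# < δ
      0<δ = <⇒0<- xf<x
      N·δ≤x : ∀ N v → Iter RN f N x v → N · δ ≤ x
      N·δ≤x N v it = begin
        N · δ       ≤⟨ ≤-+-nonneg (N · δ) (iterate-nonneg it 0≤x) ⟩
        v + N · δ   ≤⟨ descent dx (proj₁ 0<δ) N it ≤-refl ⟩
        x           ∎

    unbounded : ∀ {x} → 0# ≤ x → (dx : Dom f x) → x < app f x dx →
                ∀ P → ∃ λ N → ∃ λ v → Iter RN f N x v × P ≤ v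
    unbounded {x} 0≤x dx x<xf P =
      let N , P<N·γ = archimedean-multiple 0<γ P
          v , it , x+N·γ≤v = ascent dx (proj₁ 0<γ) N x ≤-refl
      in N , v , it , (begin
        P           ≤⟨ proj₁ P<N·γ ⟩
        N · γ       ≤⟨ ≤-+-nonneg (N · γ) 0≤x ⟩
        x + N · γ   ≤⟨ x+N·γ≤v ⟩
        v           ∎)
      where
      γ = app f x dx - x
      0<γ : 0# < γ
      0<γ = <⇒0<- x<xf

open Energy using (eventually-undefined; unbounded)

mainTheorem8 : (RN : RealNumbers) → let open RealNumbers RN in
    (f : EnergyFunction RN) (x : ℝ) → 0# ≤ x →
    ((dx : EnergyFunction.Dom f x) → EnergyFunction.app f x dx < x →
       ∃ λ (N : ℕ) → ¬ (∃ λ v → Iter RN f N x v))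
    ×
    ((dx : EnergyFunction.Dom f x) → x < EnergyFunction.app f x dx →
       (P : ℝ) → ∃ λ (N : ℕ) → ∃ λ v → Iter RN f N x v × P ≤ v)
mainTheorem8 RN f x 0≤x = eventually-undefined RN f 0≤x , unbounded RN f 0≤x
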